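{- Every pseudocylinder (in particular every cylinder) is fully balanced, i.e., fully balanced with respect to each $u\in\Delta$.
   Context: A basic cube is $C=(x,y,z)+[0,1]^3$ with $(x,y,z)\in\mathbb{Z}^3$; it is black if $x+y+z$ is odd and white if even. A region is a finite union of basic cubes. $\Delta=\{e_x,e_y,e_z\}$. For $X\subset\mathbb{R}^3$ and $u\in\{\pm e_x,\pm e_y,\pm e_z\}$, $S^u(X)=\operatorname{int}\big((X+[0,\infty)u)\setminus X\big)$ and $\overline{S}^u(X)$ is its closure. A region $\mathcal{R}$ is fully balanced with respect to $u\in\Delta$ if for every square $Q=p+[0,2]a+[0,2]b\subset\mathcal{R}$ with $p\in\mathbb{Z}^3$ and $a,b\in\Delta$ the two vectors of $\Delta$ other than $u$, each of the sets $\mathcal{R}\cap\overline{S}^{u}(Q)$ and $\mathcal{R}\cap\overline{S}^{ -u}(Q)$ contains as many black basic cubes as white ones. A basic plane is $\{x=k\}$, $\{y=k\}$ or $\{z=k\}$, $k\in\mathbb{Z}$; a planar region in it is a finite union of unit squares in it with vertices in $\mathbb{Z}^3$. A pseudocylinder with base $\mathcal{D}$, axis $w\in\Delta$ and depth $n\in\mathbb{Z}_{>0}$ is a region $\mathcal{D}+[0,n]w$ where $\mathcal{D}$ is a planar region with connected interior in a basic plane with normal $w$; a cylinder is a pseudocylinder whose base is simply connected. -}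

module Defs where

open import Data.Bool using (Bool; true; false; _∧_; _∨_; not; T)
open import Data.Nat using (ℕ; _%_) renaming (_≡ᵇ_ to _≡ℕᵇ_; _<_ to _<ℕ_)
open import Data.Integer using (ℤ; _+_; _-_; ∣_∣; _≤_; +_; 1ℤ)
import Data.Integer as ℤ
open import Data.Fin using (Fin; zero; suc)
open import Data.List using (List; length; filterᵇ; allFin)
import Data.List as L
open import Data.Bool.ListAction using (and)
open import Data.List.Membership.Propositional using (_∈_)
open import Data.Product using (_×_; Σ; ∃; _,_)
open import Data.Sum using (_⊎_)
open import Relation.Binary.PropositionalEquality using (_≡_)
open import Relation.Nullary.Decidable using (⌊_⌋)
open import Data.Fin.Properties using () renaming (_≟_ to _≟F_)

-- A basic cube (x,y,z) + [0,1]^3 is represented by its corner (x,y,z) ∈ ℤ³.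
Cube : Set
Cube = ℤ × ℤ × ℤ

-- Axes: Δ = {e_x, e_y, e_z} indexed by Fin 3 (0 ↦ x, 1 ↦ y, 2 ↦ z).
Axis : Set
Axis = Fin 3

coord : Axis → Cube → ℤ
coord zero          (x , y , z) = x
coord (suc zero)    (x , y , z) = y
coord (suc (suc zero)) (x , y , z) = z

shift : Axis → ℤ → Cube → Cube
shift zero             j (x , y , z) = (x + j , y , z)
shift (suc zero)       j (x , y , z) = (x , y + j , z)
shift (suc (suc zero)) j (x , y , z) = (x , y , z + j)

isBlack : Cube → Bool
isBlack (x , y , z) = (∣ x + y + z ∣ % 2) ≡ℕᵇ 1

_==_ : ℤ → ℤ → Bool
a == b = ⌊ a ℤ.≟ b ⌋

_≤ᵇ_ : ℤ → ℤ → Bool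
a ≤ᵇ b = ⌊ a ℤ.≤? b ⌋

-- c lies (as a basic cube) in the closed 2x2 column p + [0,2]a + [0,2]b + ℝu,
-- where a, b are the two axes other than u
inColumn : Axis → Cube → Cube → Bool
inColumn u p c = and (L.map ok (allFin 3))
  where
  ok : Axis → Bool
  ok v = ⌊ v ≟F u ⌋ ∨ (coord v c == coord v p) ∨ (coord v c == (coord v p + 1ℤ))

-- the basic cube c is contained in  S̄^{u}(Q)  (closure of the +u shadow of
-- Q = p + [0,2]a + [0,2]b), i.e. in p + [0,2]a + [0,2]b + [0,∞)u
inShadow+ : Axis → Cube → Cube → Bool
inShadow+ u p c = inColumn u p c ∧ (coord u p ≤ᵇ coord u c)

-- the basic cube c is contained in  S̄^{-u}(Q) = p + [0,2]a + [0,2]b + (-∞,0]u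
inShadow- : Axis → Cube → Cube → Bool
inShadow- u p c = inColumn u p c ∧ ((coord u c + 1ℤ) ≤ᵇ coord u p)

-- A region: finite union of basic cubes, given by a duplicate-free list of cubes.
-- Number of basic cubes of the region R satisfying f.
count : (Cube → Bool) → List Cube → ℕ
count f R = length (filterᵇ f R)

-- The square Q = p + [0,2]a + [0,2]b (a,b the axes ≠ u) is contained in R:
-- each of its four unit squares (identified by the cube c right on its +u side)
-- is covered by the cube on its +u side or the cube on its -u side.
SquareIn : List Cube → Axis → Cube → Set
SquareIn R u p = (c : Cube) → T (inColumn u p c) → coord u c ≡ coord u p →
                 (c ∈ R) ⊎ (shift u (ℤ.- 1ℤ) c ∈ R)

FullyBalancedWrt : List Cube → Axis → Set
FullyBalancedWrt R u = (p : Cube) → SquareIn R u p →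
  (count (λ c → inShadow+ u p c ∧ isBlack c) R ≡ count (λ c → inShadow+ u p c ∧ not (isBlack c)) R)
  × (count (λ c → inShadow- u p c ∧ isBlack c) R ≡ count (λ c → inShadow- u p c ∧ not (isBlack c)) R)

FullyBalanced : List Cube → Set
FullyBalanced R = (u : Axis) → FullyBalancedWrt R u

-- Planar region in the basic plane {coord w = k}: list of unit squares, each
-- identified by the basic cube d with coord w d ≡ k having it as its (-w)-face.
Adjacent : Cube → Cube → Set
Adjacent d d' = Σ Axis λ v → (d' ≡ shift v 1ℤ d) ⊎ (d ≡ shift v 1ℤ d')

-- Connectivity of the interior of a union of unit squares = connectivity of the
-- edge-adjacency graph on its squares.
data Connected (D : List Cube) : Cube → Cube → Set where
  here : ∀ {d} → d ∈ D → Connected D d d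
  step : ∀ {d d' e} → d ∈ D → Adjacent d d' → Connected D d' e → Connected D d e

HasConnectedInterior : List Cube → Set
HasConnectedInterior D = ∀ {d d'} → d ∈ D → d' ∈ D → Connected D d d'

-- R is (as a set of basic cubes) the pseudocylinder D + [0,n]w, with D a planar
-- region with connected interior in the plane {coord w = k}, n > 0.
IsPseudocylinder : List Cube → Set
IsPseudocylinder R =
  Σ Axis λ w → Σ ℤ λ k → Σ ℕ λ n → Σ (List Cube) λ D →
    (0 <ℕ n)
    × (∀ {d} → d ∈ D → coord w d ≡ k)
    × HasConnectedInterior D
    × (∀ c → c ∈ R → Σ Cube λ d → Σ ℕ λ j → (j <ℕ n) × (d ∈ D) × (c ≡ shift w (+ j) d))
    × (∀ d j → d ∈ D → j <ℕ n → shift w (+ j) d ∈ R)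

-- Fix a square Q at p orthogonal to u and an axis v ≢ u. Exchanging the two layers of the
-- 2×2 column over Q that are orthogonal to v is an involution of the column which preserves
-- both shadows of Q and changes the colour of every cube, so it pairs the black and the white
-- cubes of R in each shadow as soon as R is closed under it. A pseudocylinder with axis w is
-- the product of its base with an interval of w-coordinates, and it is closed under the
-- exchange along v = w if u ≢ w, and along any v ≢ u if u ≡ w: the exchanged cube agrees
-- with its preimage on one side of this product decomposition and with a cube of R next to Q
-- (which exists because Q ⊆ R) on the other.

module Submission where

open import Defs
open import Data.List using (List)
open import Data.List.Relation.Unary.Unique.Propositional using (Unique)

open import Data.Bool using (Bool; _∧_; _∨_; not; T)
open import Data.Bool.ListAction using (and)
open import Data.Bool.Properties using (T-∧; ∨-comm; not-involutive)
open import Data.Nat using (ℕ; zero; suc; _%_; _≡ᵇ_)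
import Data.Nat.Properties as ℕ
open import Data.Integer using (ℤ; +_; -[1+_]; _+_; _-_; -_; 1ℤ; ∣_∣)
import Data.Integer as ℤ
open import Data.Integer.Tactic.RingSolver using (solve-∀)
open import Data.Fin using (zero; suc; punchIn)
open import Data.Fin.Properties using (punchInᵢ≢i) renaming (_≟_ to _≟F_)
open import Data.List using (map; length; filterᵇ; allFin)
open import Data.List.Properties using (map-cong; length-map)
open import Data.List.Relation.Unary.All as All using ()
open import Data.List.Relation.Unary.All.Properties using (all⁺)
open import Data.List.Membership.Propositional using (_∈_)
open import Data.List.Membership.Propositional.Properties
  using (∈-map⁺; ∈-map⁻; ∈-filter⁺; ∈-filter⁻; ∈-allFin)
open import Data.List.Membership.Propositional.Properties.WithK using (unique∧set⇒bag)
import Data.List.Relation.Unary.Unique.Propositional.Properties as Unique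
open import Data.List.Relation.Binary.BagAndSetEquality using (∼bag⇒↭)
open import Data.List.Relation.Binary.Permutation.Propositional.Properties using (↭-length)
open import Data.Product using (∃-syntax; _×_; _,_; proj₁)
open import Data.Sum using (_⊎_; inj₁; inj₂)
open import Function using (_∘_; mk⇔; Equivalence)
open import Relation.Nullary using (Dec; yes; no; contradiction)
open import Relation.Nullary.Decidable using (⌊_⌋; T?)
open import Relation.Binary.PropositionalEquality

open Equivalence using (to; from)

involution⇒length≡ : {A : Set} {τ : A → A} {xs ys : List A} →
  (∀ x → τ (τ x) ≡ x) → Unique xs → Unique ys →
  (∀ {x} → x ∈ xs → τ x ∈ ys) → (∀ {y} → y ∈ ys → τ y ∈ xs) →
  length xs ≡ length ys
involution⇒length≡ {τ = τ} {xs} {ys} τ-inv xs! ys! xs→ys ys→xs = begin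
  length xs          ≡⟨ length-map τ xs ⟨
  length (map τ xs)  ≡⟨ ↭-length (∼bag⇒↭ (unique∧set⇒bag τxs! ys! (mk⇔ onto into))) ⟩
  length ys          ∎
  where
  open ≡-Reasoning
  τ-injective : ∀ {x y} → τ x ≡ τ y → x ≡ y
  τ-injective {x} {y} e = trans (sym (τ-inv x)) (trans (cong τ e) (τ-inv y))
  τxs! : Unique (map τ xs)
  τxs! = Unique.map⁺ τ-injective xs!
  onto : ∀ {y} → y ∈ map τ xs → y ∈ ys
  onto m with ∈-map⁻ τ m
  ... | x , x∈xs , refl = xs→ys x∈xs
  into : ∀ {y} → y ∈ ys → y ∈ map τ xs
  into {y} m = subst (_∈ map τ xs) (τ-inv y) (∈-map⁺ τ (ys→xs m))

isOddℕ : ℕ → Bool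
isOddℕ n = (n % 2) ≡ᵇ 1

isOddℕ-suc : ∀ n → isOddℕ (suc n) ≡ not (isOddℕ n)
isOddℕ-suc zero          = refl
isOddℕ-suc (suc zero)    = refl
isOddℕ-suc (suc (suc n)) = isOddℕ-suc n

isOdd : ℤ → Bool
isOdd s = isOddℕ ∣ s ∣

isOdd-+1 : ∀ s → isOdd (s + 1ℤ) ≡ not (isOdd s)
isOdd-+1 (+ m)            = trans (cong isOddℕ (ℕ.+-comm m 1)) (isOddℕ-suc m)
isOdd-+1 -[1+ zero ]      = refl
isOdd-+1 -[1+ suc m ]     =
  sym (trans (cong not (isOddℕ-suc (suc m))) (not-involutive _))

coordSum : Cube → ℤ
coordSum (x , y , z) = x + y + z

isBlack≡isOdd : ∀ c → isBlack c ≡ isOdd (coordSum c)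
isBlack≡isOdd (x , y , z) = refl

coordSum-shift : ∀ v j c → coordSum (shift v j c) ≡ coordSum c + j
coordSum-shift zero             j (x , y , z) = shift-x x y z j
  where shift-x : ∀ x y z j → x + j + y + z ≡ x + y + z + j
        shift-x = solve-∀
coordSum-shift (suc zero)       j (x , y , z) = shift-y x y z j
  where shift-y : ∀ x y z j → x + (y + j) + z ≡ x + y + z + j
        shift-y = solve-∀
coordSum-shift (suc (suc zero)) j (x , y , z) = shift-z x y z j
  where shift-z : ∀ x y z j → x + y + (z + j) ≡ x + y + z + j
        shift-z = solve-∀

isBlack-shift : ∀ v c → isBlack (shift v 1ℤ c) ≡ not (isBlack c)
isBlack-shift v c = begin
  isBlack (shift v 1ℤ c)        ≡⟨ isBlack≡isOdd (shift v 1ℤ c) ⟩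
  isOdd (coordSum (shift v 1ℤ c)) ≡⟨ cong isOdd (coordSum-shift v 1ℤ c) ⟩
  isOdd (coordSum c + 1ℤ)       ≡⟨ isOdd-+1 (coordSum c) ⟩
  not (isOdd (coordSum c))      ≡⟨ cong not (isBlack≡isOdd c) ⟨
  not (isBlack c)               ∎
  where open ≡-Reasoning

AgreeOff : Axis → Cube → Cube → Set
AgreeOff w c c′ = ∀ v → v ≢ w → coord v c ≡ coord v c′

coord-ext : ∀ {c c′} → (∀ v → coord v c ≡ coord v c′) → c ≡ c′
coord-ext {x , y , z} {x′ , y′ , z′} h =
  cong₂ _,_ (h zero) (cong₂ _,_ (h (suc zero)) (h (suc (suc zero))))

coord-ext-off : ∀ w {c c′} → coord w c ≡ coord w c′ → AgreeOff w c c′ → c ≡ c′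
coord-ext-off w {c} {c′} on off = coord-ext at
  where
  at : ∀ v → coord v c ≡ coord v c′
  at v with v ≟F w
  ... | yes refl = on
  ... | no v≢w   = off v v≢w

mapCoord : Axis → (ℤ → ℤ) → Cube → Cube
mapCoord zero             f (x , y , z) = (f x , y , z)
mapCoord (suc zero)       f (x , y , z) = (x , f y , z)
mapCoord (suc (suc zero)) f (x , y , z) = (x , y , f z)

coord-mapCoord : ∀ v f c → coord v (mapCoord v f c) ≡ f (coord v c)
coord-mapCoord zero             f (x , y , z) = refl
coord-mapCoord (suc zero)       f (x , y , z) = refl
coord-mapCoord (suc (suc zero)) f (x , y , z) = refl

mapCoord-agreeOff : ∀ v f c → AgreeOff v (mapCoord v f c) c
mapCoord-agreeOff zero             f c                 zero             ne = contradiction refl ne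
mapCoord-agreeOff zero             f (x , y , z)       (suc zero)       ne = refl
mapCoord-agreeOff zero             f (x , y , z)       (suc (suc zero)) ne = refl
mapCoord-agreeOff (suc zero)       f (x , y , z)       zero             ne = refl
mapCoord-agreeOff (suc zero)       f c                 (suc zero)       ne = contradiction refl ne
mapCoord-agreeOff (suc zero)       f (x , y , z)       (suc (suc zero)) ne = refl
mapCoord-agreeOff (suc (suc zero)) f (x , y , z)       zero             ne = refl
mapCoord-agreeOff (suc (suc zero)) f (x , y , z)       (suc zero)       ne = refl
mapCoord-agreeOff (suc (suc zero)) f c                 (suc (suc zero)) ne = contradiction refl ne

mapCoord-cong : ∀ v f g c → f (coord v c) ≡ g (coord v c) → mapCoord v f c ≡ mapCoord v g c
mapCoord-cong zero             f g (x , y , z) e = cong (λ a → (a , y , z)) e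
mapCoord-cong (suc zero)       f g (x , y , z) e = cong (λ a → (x , a , z)) e
mapCoord-cong (suc (suc zero)) f g (x , y , z) e = cong (λ a → (x , y , a)) e

mapCoord-involutive : ∀ v {f} → (∀ t → f (f t) ≡ t) → ∀ c → mapCoord v f (mapCoord v f c) ≡ c
mapCoord-involutive zero             f-inv (x , y , z) = cong (λ a → (a , y , z)) (f-inv x)
mapCoord-involutive (suc zero)       f-inv (x , y , z) = cong (λ a → (x , a , z)) (f-inv y)
mapCoord-involutive (suc (suc zero)) f-inv (x , y , z) = cong (λ a → (x , y , a)) (f-inv z)

shift≡mapCoord : ∀ v j c → shift v j c ≡ mapCoord v (_+ j) c
shift≡mapCoord zero             j (x , y , z) = refl
shift≡mapCoord (suc zero)       j (x , y , z) = refl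
shift≡mapCoord (suc (suc zero)) j (x , y , z) = refl

coord-shift : ∀ v j c → coord v (shift v j c) ≡ coord v c + j
coord-shift v j c = trans (cong (coord v) (shift≡mapCoord v j c)) (coord-mapCoord v (_+ j) c)

shift-agreeOff : ∀ v j c → AgreeOff v (shift v j c) c
shift-agreeOff v j c v′ ne =
  trans (cong (coord v′) (shift≡mapCoord v j c)) (mapCoord-agreeOff v (_+ j) c v′ ne)

reflect : ℤ → ℤ → ℤ
reflect q t = q + (q + 1ℤ) - t

-- The ring solver does not unfold reflect, hence the restated goals below.
reflect-involutive : ∀ q t → reflect q (reflect q t) ≡ t
reflect-involutive = involutive
  where involutive : ∀ q t → q + (q + 1ℤ) - (q + (q + 1ℤ) - t) ≡ t
        involutive = solve-∀

reflect-lower : ∀ q → reflect q q ≡ q + 1ℤ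
reflect-lower = lower
  where lower : ∀ q → q + (q + 1ℤ) - q ≡ q + 1ℤ
        lower = solve-∀

reflect-upper : ∀ q → reflect q (q + 1ℤ) ≡ q
reflect-upper = upper
  where upper : ∀ q → q + (q + 1ℤ) - (q + 1ℤ) ≡ q
        upper = solve-∀

⌊⌋-cong : {P Q : Set} (P? : Dec P) (Q? : Dec Q) → (P → Q) → (Q → P) → ⌊ P? ⌋ ≡ ⌊ Q? ⌋
⌊⌋-cong (yes _)  (yes _)  _   _   = refl
⌊⌋-cong (no _)   (no _)   _   _   = refl
⌊⌋-cong (yes p)  (no ¬q)  p→q _   = contradiction (p→q p) ¬q
⌊⌋-cong (no ¬p)  (yes q)  _   q→p = contradiction (q→p q) ¬p

==-involutive : ∀ (f : ℤ → ℤ) → (∀ t → f (f t) ≡ t) → ∀ a b → (f a == b) ≡ (a == f b)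
==-involutive f f-inv a b = ⌊⌋-cong (f a ℤ.≟ b) (a ℤ.≟ f b)
  (λ e → trans (sym (f-inv a)) (cong f e))
  (λ e → trans (cong f e) (f-inv b))

inLayers : ℤ → ℤ → Bool
inLayers q t = (t == q) ∨ (t == (q + 1ℤ))

inLayers-reflect : ∀ q t → inLayers q (reflect q t) ≡ inLayers q t
inLayers-reflect q t = begin
  (reflect q t == q) ∨ (reflect q t == (q + 1ℤ))
    ≡⟨ cong₂ _∨_ (==-involutive (reflect q) (reflect-involutive q) t q)
                 (==-involutive (reflect q) (reflect-involutive q) t (q + 1ℤ)) ⟩
  (t == reflect q q) ∨ (t == reflect q (q + 1ℤ))
    ≡⟨ cong₂ (λ a b → (t == a) ∨ (t == b)) (reflect-lower q) (reflect-upper q) ⟩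
  (t == (q + 1ℤ)) ∨ (t == q)
    ≡⟨ ∨-comm (t == (q + 1ℤ)) (t == q) ⟩
  inLayers q t ∎
  where open ≡-Reasoning

swapLayers : Axis → ℤ → Cube → Cube
swapLayers v q = mapCoord v (reflect q)

swapLayers-involutive : ∀ v q c → swapLayers v q (swapLayers v q c) ≡ c
swapLayers-involutive v q = mapCoord-involutive v (reflect-involutive q)

swapLayers-lower : ∀ v q c → coord v c ≡ q → swapLayers v q c ≡ shift v 1ℤ c
swapLayers-lower v q c refl =
  trans (mapCoord-cong v (reflect q) (_+ 1ℤ) c (reflect-lower (coord v c))) (sym (shift≡mapCoord v 1ℤ c))

T-inLayers : ∀ q t → T (inLayers q t) → (t ≡ q) ⊎ (t ≡ q + 1ℤ)
T-inLayers q t layers with t ℤ.≟ q | t ℤ.≟ (q + 1ℤ)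
... | yes lower | _         = inj₁ lower
... | no _      | yes upper = inj₂ upper
T-inLayers q t () | no _ | no _

isBlack-swapLayers-lower : ∀ v q c → coord v c ≡ q → isBlack (swapLayers v q c) ≡ not (isBlack c)
isBlack-swapLayers-lower v q c lower =
  trans (cong isBlack (swapLayers-lower v q c lower)) (isBlack-shift v c)

isBlack-swapLayers : ∀ v q c → T (inLayers q (coord v c)) →
                     isBlack (swapLayers v q c) ≡ not (isBlack c)
isBlack-swapLayers v q c layers with T-inLayers q (coord v c) layers
... | inj₁ lower = isBlack-swapLayers-lower v q c lower
... | inj₂ upper = begin
  isBlack c′                            ≡⟨ not-involutive _ ⟨
  not (not (isBlack c′))                ≡⟨ cong not (isBlack-swapLayers-lower v q c′ c′-lower) ⟨
  not (isBlack (swapLayers v q c′))     ≡⟨ cong (not ∘ isBlack) (swapLayers-involutive v q c) ⟩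
  not (isBlack c)                       ∎
  where
  open ≡-Reasoning
  c′ : Cube
  c′ = swapLayers v q c
  c′-lower : coord v c′ ≡ q
  c′-lower = trans (coord-mapCoord v (reflect q) c) (trans (cong (reflect q) upper) (reflect-upper q))

columnTest : Axis → Cube → Cube → Axis → Bool
columnTest u p c v = ⌊ v ≟F u ⌋ ∨ inLayers (coord v p) (coord v c)

inColumn-cong : ∀ u p {c c′} →
  (∀ v → v ≢ u → inLayers (coord v p) (coord v c) ≡ inLayers (coord v p) (coord v c′)) →
  inColumn u p c ≡ inColumn u p c′
inColumn-cong u p {c} {c′} layers≡ = cong and (map-cong test≡ (allFin 3))
  where
  test≡ : ∀ v → columnTest u p c v ≡ columnTest u p c′ v
  test≡ v with v ≟F u
  ... | yes _   = refl
  ... | no v≢u  = layers≡ v v≢u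

inColumn-layers : ∀ u p c v → T (inColumn u p c) → v ≢ u → T (inLayers (coord v p) (coord v c))
inColumn-layers u p c v column v≢u =
  drop (v ≟F u) (All.lookup (all⁺ (columnTest u p c) (allFin 3) column) (∈-allFin v))
  where
  drop : ∀ {b} (v≟u : Dec (v ≡ u)) → T (⌊ v≟u ⌋ ∨ b) → T b
  drop (yes v≡u) _ = contradiction v≡u v≢u
  drop (no _)    t = t

inColumn-agreeOff : ∀ u p {c c′} → AgreeOff u c c′ → inColumn u p c ≡ inColumn u p c′
inColumn-agreeOff u p agree = inColumn-cong u p λ v v≢u → cong (inLayers _) (agree v v≢u)

inColumn-swapLayers : ∀ u p v c → inColumn u p (swapLayers v (coord v p) c) ≡ inColumn u p c
inColumn-swapLayers u p v c = inColumn-cong u p layers≡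
  where
  layers≡ : ∀ v′ → v′ ≢ u →
    inLayers (coord v′ p) (coord v′ (swapLayers v (coord v p) c)) ≡ inLayers (coord v′ p) (coord v′ c)
  layers≡ v′ _ with v′ ≟F v
  ... | yes refl = trans (cong (inLayers (coord v p)) (coord-mapCoord v (reflect (coord v p)) c))
                         (inLayers-reflect (coord v p) (coord v c))
  ... | no v′≢v  = cong (inLayers (coord v′ p)) (mapCoord-agreeOff v (reflect (coord v p)) c v′ v′≢v)

module _ {u v : Axis} (v≢u : v ≢ u) (p c : Cube) where

  private
    coord-u-swapLayers : coord u (swapLayers v (coord v p) c) ≡ coord u c
    coord-u-swapLayers = mapCoord-agreeOff v (reflect (coord v p)) c u (v≢u ∘ sym)

  inShadow+-swapLayers : inShadow+ u p (swapLayers v (coord v p) c) ≡ inShadow+ u p c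
  inShadow+-swapLayers =
    cong₂ _∧_ (inColumn-swapLayers u p v c) (cong (coord u p ≤ᵇ_) coord-u-swapLayers)

  inShadow--swapLayers : inShadow- u p (swapLayers v (coord v p) c) ≡ inShadow- u p c
  inShadow--swapLayers =
    cong₂ _∧_ (inColumn-swapLayers u p v c) (cong (λ t → (t + 1ℤ) ≤ᵇ coord u p) coord-u-swapLayers)

swapLayers-balances : ∀ {R} (S : Cube → Bool) v q → Unique R →
  (∀ c → S (swapLayers v q c) ≡ S c) →
  (∀ {c} → T (S c) → T (inLayers q (coord v c))) →
  (∀ {c} → c ∈ R → T (S c) → swapLayers v q c ∈ R) →
  count (λ c → S c ∧ isBlack c) R ≡ count (λ c → S c ∧ not (isBlack c)) R
swapLayers-balances {R} S v q R! S-invariant layers closed =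
  involution⇒length≡ (swapLayers-involutive v q)
    (Unique.filter⁺ (T? ∘ (S ∧′ isBlack)) R!) (Unique.filter⁺ (T? ∘ (S ∧′ (not ∘ isBlack))) R!)
    (move isBlack (not ∘ isBlack) λ Sc →
      trans (cong not (isBlack-swapLayers v q _ (layers Sc))) (not-involutive _))
    (move (not ∘ isBlack) isBlack λ Sc → isBlack-swapLayers v q _ (layers Sc))
  where
  _∧′_ : (Cube → Bool) → (Cube → Bool) → Cube → Bool
  (P ∧′ P′) c = P c ∧ P′ c
  move : ∀ P P′ → (∀ {c} → T (S c) → P′ (swapLayers v q c) ≡ P c) →
         ∀ {c} → c ∈ filterᵇ (S ∧′ P) R → swapLayers v q c ∈ filterᵇ (S ∧′ P′) R
  move P P′ P′≡P {c} c∈ with ∈-filter⁻ (T? ∘ (S ∧′ P)) c∈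
  ... | c∈R , SPc with to T-∧ SPc
  ... | Sc , Pc = ∈-filter⁺ (T? ∘ (S ∧′ P′)) (closed c∈R Sc)
                    (from T-∧ (subst T (sym (S-invariant c)) Sc , subst T (sym (P′≡P Sc)) Pc))

SwapClosed : List Cube → Axis → Cube → Axis → Set
SwapClosed R u p v = ∀ {c} → c ∈ R → T (inColumn u p c) → swapLayers v (coord v p) c ∈ R

swapClosed⇒balanced : ∀ {R u v} → Unique R → v ≢ u → ∀ p → SwapClosed R u p v →
  (count (λ c → inShadow+ u p c ∧ isBlack c) R ≡ count (λ c → inShadow+ u p c ∧ not (isBlack c)) R)
  × (count (λ c → inShadow- u p c ∧ isBlack c) R ≡ count (λ c → inShadow- u p c ∧ not (isBlack c)) R)
swapClosed⇒balanced {R} {u} {v} R! v≢u p closed =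
    swapLayers-balances (inShadow+ u p) v (coord v p) R! (inShadow+-swapLayers v≢u p)
      (λ {c} → layers c ∘ column c) (λ {c} c∈R → closed c∈R ∘ column c)
  , swapLayers-balances (inShadow- u p) v (coord v p) R! (inShadow--swapLayers v≢u p)
      (λ {c} → layers c ∘ column c) (λ {c} c∈R → closed c∈R ∘ column c)
  where
  column : ∀ c {b} → T (inColumn u p c ∧ b) → T (inColumn u p c)
  column c = proj₁ ∘ to T-∧
  layers : ∀ c → T (inColumn u p c) → T (inLayers (coord v p) (coord v c))
  layers c col = inColumn-layers u p c v col v≢u

-- R is the product of its projection along w with the set of w-coordinates of its cubes.
IsProductAlong : List Cube → Axis → Set
IsProductAlong R w = ∀ {c e c′} → c ∈ R → e ∈ R →
  coord w c′ ≡ coord w c → AgreeOff w c′ e → c′ ∈ R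

pseudocylinder⇒product : ∀ {R} → IsPseudocylinder R → ∃[ w ] IsProductAlong R w
pseudocylinder⇒product {R} (w , k , n , D , _ , D-level , _ , R⊆ , R⊇) = w , product
  where
  product : IsProductAlong R w
  product {c′ = c′} c∈R e∈R on off with R⊆ _ c∈R | R⊆ _ e∈R
  ... | d , j , j<n , d∈D , refl | d′ , j′ , _ , d′∈D , refl =
    subst (_∈ R) (sym c′≡) (R⊇ d′ j d′∈D j<n)
    where
    open ≡-Reasoning
    c′≡ : c′ ≡ shift w (+ j) d′
    c′≡ = coord-ext-off w
      (begin
        coord w c′                 ≡⟨ on ⟩
        coord w (shift w (+ j) d)  ≡⟨ coord-shift w (+ j) d ⟩
        coord w d + + j            ≡⟨ cong (_+ + j) (trans (D-level d∈D) (sym (D-level d′∈D))) ⟩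
        coord w d′ + + j           ≡⟨ coord-shift w (+ j) d′ ⟨
        coord w (shift w (+ j) d′) ∎)
      (λ v v≢w → trans (off v v≢w)
                   (trans (shift-agreeOff w (+ j′) d′ v v≢w) (sym (shift-agreeOff w (+ j) d′ v v≢w))))

squareIn⇒agreeing : ∀ {R u p} → SquareIn R u p →
  ∀ {c} → T (inColumn u p c) → ∃[ e ] e ∈ R × AgreeOff u c e
squareIn⇒agreeing {R} {u} {p} square {c} column =
  pick (square c₀ column₀ (coord-mapCoord u (λ _ → coord u p) c))
  where
  c₀ : Cube
  c₀ = mapCoord u (λ _ → coord u p) c
  c₀≈c : AgreeOff u c₀ c
  c₀≈c = mapCoord-agreeOff u (λ _ → coord u p) c
  column₀ : T (inColumn u p c₀)
  column₀ = subst T (sym (inColumn-agreeOff u p c₀≈c)) column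
  pick : (c₀ ∈ R) ⊎ (shift u (- 1ℤ) c₀ ∈ R) → ∃[ e ] e ∈ R × AgreeOff u c e
  pick (inj₁ c₀∈R)    = c₀ , c₀∈R , λ v v≢u → sym (c₀≈c v v≢u)
  pick (inj₂ below∈R) = shift u (- 1ℤ) c₀ , below∈R , λ v v≢u →
    sym (trans (shift-agreeOff u (- 1ℤ) c₀ v v≢u) (c₀≈c v v≢u))

product⇒swapClosed : ∀ {R w u p} → IsProductAlong R w → SquareIn R u p →
  ∃[ v ] v ≢ u × SwapClosed R u p v
product⇒swapClosed {R} {w} {u} {p} product square with u ≟F w
... | yes refl = punchIn u zero , punchInᵢ≢i u zero , closed
  where
  v : Axis
  v = punchIn u zero
  closed : SwapClosed R u p v
  closed {c} c∈R column with squareIn⇒agreeing square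
                              (subst T (sym (inColumn-swapLayers u p v c)) column)
  ... | e , e∈R , c′≈e =
    product c∈R e∈R (mapCoord-agreeOff v (reflect (coord v p)) c u (punchInᵢ≢i u zero ∘ sym)) c′≈e
... | no u≢w = w , w≢u , closed
  where
  w≢u : w ≢ u
  w≢u = u≢w ∘ sym
  closed : SwapClosed R u p w
  closed {c} c∈R column with squareIn⇒agreeing square
                              (subst T (sym (inColumn-swapLayers u p w c)) column)
  ... | e , e∈R , c′≈e =
    product e∈R c∈R (c′≈e w w≢u) (mapCoord-agreeOff w (reflect (coord w p)) c)

lemma3p5 : (R : List Cube) → Unique R → IsPseudocylinder R → FullyBalanced R
lemma3p5 R R! cylinder u p square with pseudocylinder⇒product cylinder
... | w , product with product⇒swapClosed product square
... | v , v≢u , closed = swapClosed⇒balanced R! v≢u p closed
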